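{- For $n\ge 4$, the polynomial profile of \textsc{Cis} played on the cycle $C_n$ satisfies \[P_{\textsc{Cis},C_n}(x,y)=P_{\textsc{Cis},P_{n-1}}(x,y)+(x+y)P_{\textsc{Cis},P_{n-3}}(x,y),\] and the total number of positions is $P_{\textsc{Cis},C_n}(1,1)=2^{n}+(-1)^n$.
   Context: A distance game given by a pair of sets $(S,D)$ of positive integers is played on a finite graph by two players, Left (colouring vertices blue) and Right (colouring vertices red). A position is any assignment to a subset of the vertices of the colours blue or red (other vertices empty) such that no two vertices of the same colour are at graph distance in $S$ and no two vertices of different colours are at graph distance in $D$; no assumption of alternating play is made. \textsc{Cis} is the distance game with $S=D=\{1\}$, i.e. no two coloured vertices may be adjacent. The polynomial profile is $P_{G,B}(x,y)=\sum f_{j,l}x^jy^l$ with $f_{j,l}$ the number of positions with $j$ blue and $l$ red vertices. $P_n$ is the path and $C_n$ the cycle with $n$ vertices. -}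

module Defs where

open import Data.Nat using (ℕ; zero; suc; _+_; _*_; _^_; _≡ᵇ_)
open import Data.Bool using (Bool; true; false; _∧_; _∨_; not; if_then_else_)
open import Data.Fin using (Fin; toℕ)
open import Data.Vec using (Vec; []; _∷_; lookup)
open import Data.List using (List; []; _∷_; map; filter; length; concatMap; allFin)
open import Data.Product using (_×_; _,_)
open import Function using (_∘_)
open import Data.Nat.ListAction using (sum)
open import Data.Bool.ListAction using (all)
open import Relation.Binary.PropositionalEquality using (_≡_)
open import Relation.Nullary.Decidable using (Dec; yes; no)
open import Data.Bool using (T)
import Data.Bool.Properties as BP

Graph : ℕ → Set
Graph n = Fin n → Fin n → Bool

pathGraph : (n : ℕ) → Graph n
pathGraph n i j = (suc (toℕ i) ≡ᵇ toℕ j) ∨ (suc (toℕ j) ≡ᵇ toℕ i)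

cycleGraph : (n : ℕ) → Graph n
cycleGraph n i j = pathGraph n i j
                 ∨ ((toℕ i ≡ᵇ 0) ∧ (suc (toℕ j) ≡ᵇ n))
                 ∨ ((toℕ j ≡ᵇ 0) ∧ (suc (toℕ i) ≡ᵇ n))

-- Colourings: each vertex empty, blue (Left) or red (Right).

data Colour : Set where
  empty blue red : Colour

coloured : Colour → Bool
coloured empty = false
coloured blue  = true
coloured red   = true

isBlue isRed : Colour → Bool
isBlue blue = true
isBlue _    = false
isRed red = true
isRed _   = false

assignments : (n : ℕ) → List (Vec Colour n)
assignments zero    = [] ∷ []
assignments (suc n) = concatMap (λ v → (empty ∷ v) ∷ (blue ∷ v) ∷ (red ∷ v) ∷ []) (assignments n)

-- A position of the distance game (S,D) = ({1},{1}) (Cis): no two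
-- coloured vertices at distance 1, i.e. adjacent (same colour: S = {1},
-- different colours: D = {1}).
isCisPosition : {n : ℕ} → Graph n → Vec Colour n → Bool
isCisPosition {n} G c =
  all (λ i → all (λ j → not (G i j ∧ coloured (lookup c i) ∧ coloured (lookup c j))) (allFin n)) (allFin n)

cisPositions : {n : ℕ} → Graph n → List (Vec Colour n)
cisPositions {n} G = filter (λ c → T? (isCisPosition G c)) (assignments n)
  where
  T? : (b : Bool) → Dec (T b)
  T? = BP.T?

countBool : {n : ℕ} → (Colour → Bool) → Vec Colour n → ℕ
countBool p []      = 0
countBool p (x ∷ v) = (if p x then 1 else 0) + countBool p v

-- Polynomials in x, y with ℕ coefficients, as coefficient functions
-- (j , l) ↦ coefficient of x^j y^l;  equality is coefficientwise.

Poly : Set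
Poly = ℕ → ℕ → ℕ

_≈P_ : Poly → Poly → Set
p ≈P q = ∀ j l → p j l ≡ q j l

_⊕_ : Poly → Poly → Poly
(p ⊕ q) j l = p j l + q j l

xMul : Poly → Poly
xMul p zero    l = 0
xMul p (suc j) l = p j l

yMul : Poly → Poly
yMul p j zero    = 0
yMul p j (suc l) = p j l

x+yMul : Poly → Poly
x+yMul p = xMul p ⊕ yMul p

profile : {n : ℕ} → Graph n → Poly
profile G j l =
  length (filter (λ c → BP.T? ((countBool isBlue c ≡ᵇ j) ∧ (countBool isRed c ≡ᵇ l))) (cisPositions G))

monomials : {n : ℕ} → Graph n → List (ℕ × ℕ)
monomials G = map (λ c → countBool isBlue c , countBool isRed c) (cisPositions G)

evalProfile : {n : ℕ} → Graph n → ℕ → ℕ → ℕ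
evalProfile G x y = sum (map (λ { (j , l) → x ^ j * y ^ l }) (monomials G))

-- A Cis position is a word over {empty, blue, red} with no two adjacent coloured
-- letters.  Split a cycle at its first vertex: if it is empty, the rest is a position
-- on P_(n-1); if it is blue (red), both of its neighbours must be empty, which leaves
-- a position on P_(n-3) and multiplies the monomial by x (y).  Setting x = y = 1,
-- the path counts p_t obey p_(t+2) = p_(t+1) + 2 p_t, hence so does
-- c_n = p_(n-1) + 2 p_(n-3); so does 2^n + (-1)^n, and both agree at n = 3, 4.
module Submission where

open import Defs
open import Data.Bool using (Bool; true; false; _∧_; not; if_then_else_; T)
open import Data.Bool.Properties using (T-∧; T-∨; T-≡; ⇔→≡; ∧-assoc; ∧-comm; ∧-identityʳ; ∧-zeroʳ)
open import Data.Fin using (Fin; toℕ; fromℕ) renaming (zero to fzero; suc to fsuc)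
open import Data.Fin.Properties using (toℕ-fromℕ; toℕ-injective)
open import Data.Integer using (ℤ; +_; -[1+_]) renaming (_+_ to _+ℤ_; _*_ to _*ℤ_; _^_ to _^ℤ_)
open import Data.Integer.Properties using (pos-+)
import Data.Integer.Tactic.RingSolver as ℤ-Solver
open import Data.List using (List; []; _∷_; map; filterᵇ; length; concatMap)
open import Data.List.Properties using (map-∘)
open import Data.List.Relation.Unary.All.Properties using (all⁺; all⁻; tabulate⁺; tabulate⁻)
open import Data.Nat using (ℕ; zero; suc; _+_; _*_; _^_; _≡ᵇ_; _≤_; s≤s; _∸_)
open import Data.Nat.ListAction using (sum)
open import Data.Nat.Properties using (+-assoc; +-identityʳ; ^-zeroˡ; ≡ᵇ⇒≡; ≡⇒≡ᵇ)
import Data.Nat.Tactic.RingSolver as ℕ-Solver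
open import Data.Product using (_×_; _,_; proj₁; proj₂)
open import Data.Sum using (inj₁; inj₂)
open import Data.Vec using (Vec; []; _∷_; lookup)
open import Function using (_∘_; _⇔_; mk⇔; Equivalence)
open import Relation.Binary.PropositionalEquality using (_≡_; refl; sym; trans; cong; cong₂; subst; module ≡-Reasoning)

private
  variable
    A : Set
    n : ℕ

indicator : Bool → ℕ
indicator b = if b then 1 else 0

countᵇ : (A → Bool) → List A → ℕ
countᵇ p []       = 0
countᵇ p (x ∷ xs) = indicator (p x) + countᵇ p xs

length-filterᵇ : (p : A → Bool) (xs : List A) → length (filterᵇ p xs) ≡ countᵇ p xs
length-filterᵇ p []       = refl
length-filterᵇ p (x ∷ xs) with p x
... | true  = cong suc (length-filterᵇ p xs)
... | false = length-filterᵇ p xs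

countᵇ-filterᵇ : (p q : A → Bool) (xs : List A) →
                 countᵇ q (filterᵇ p xs) ≡ countᵇ (λ x → p x ∧ q x) xs
countᵇ-filterᵇ p q []       = refl
countᵇ-filterᵇ p q (x ∷ xs) with p x
... | true  = cong (λ m → indicator (q x) + m) (countᵇ-filterᵇ p q xs)
... | false = countᵇ-filterᵇ p q xs

countᵇ-cong : {p q : A → Bool} → (∀ x → p x ≡ q x) → (xs : List A) → countᵇ p xs ≡ countᵇ q xs
countᵇ-cong p≗q []       = refl
countᵇ-cong p≗q (x ∷ xs) = cong₂ (λ b m → indicator b + m) (p≗q x) (countᵇ-cong p≗q xs)

countᵇ-none : {p : A → Bool} → (∀ x → p x ≡ false) → (xs : List A) → countᵇ p xs ≡ 0
countᵇ-none p≗false []       = refl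
countᵇ-none p≗false (x ∷ xs) rewrite p≗false x = countᵇ-none p≗false xs

count : (n : ℕ) → (Vec Colour n → Bool) → ℕ
count n p = countᵇ p (assignments n)

count-suc : (p : Vec Colour (suc n) → Bool) →
            count (suc n) p ≡ count n (p ∘ (empty ∷_)) + count n (p ∘ (blue ∷_)) + count n (p ∘ (red ∷_))
count-suc {n} p = go (assignments n)
  where
  open ℕ-Solver using (solve-∀)
  regroup : ∀ a b c x y z → a + (b + (c + (x + y + z))) ≡ (a + x) + (b + y) + (c + z)
  regroup = solve-∀
  go : (vs : List (Vec Colour n)) →
       countᵇ p (concatMap (λ v → (empty ∷ v) ∷ (blue ∷ v) ∷ (red ∷ v) ∷ []) vs)
       ≡ countᵇ (p ∘ (empty ∷_)) vs + countᵇ (p ∘ (blue ∷_)) vs + countᵇ (p ∘ (red ∷_)) vs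
  go []       = refl
  go (v ∷ vs) = trans (cong (λ m → e + (b + (r + m))) (go vs)) (regroup e b r _ _ _)
    where
    e b r : ℕ
    e = indicator (p (empty ∷ v))
    b = indicator (p (blue ∷ v))
    r = indicator (p (red ∷ v))

count-cong : {p q : Vec Colour n → Bool} → (∀ c → p c ≡ q c) → count n p ≡ count n q
count-cong {n} p≗q = countᵇ-cong p≗q (assignments n)

count-none : {p : Vec Colour n → Bool} → (∀ c → p c ≡ false) → count n p ≡ 0
count-none {n} p≗false = countᵇ-none p≗false (assignments n)

-- A selector accepts the pairs (#blue, #red) to be counted: monomial j l extracts
-- the coefficient of x^j y^l, and shifting by one blue (red) vertex is
-- multiplication by x (y).
Selector : Set
Selector = ℕ → ℕ → Bool

monomial : ℕ → ℕ → Selector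
monomial j l b r = (b ≡ᵇ j) ∧ (r ≡ᵇ l)

anyMonomial : Selector
anyMonomial _ _ = true

blueShift redShift : Selector → Selector
blueShift φ b r = φ (suc b) r
redShift  φ b r = φ b (suc r)

countSelected : (n : ℕ) → (Vec Colour n → Bool) → Selector → ℕ
countSelected n p φ = count n (λ c → p c ∧ φ (countBool isBlue c) (countBool isRed c))

countSelected-suc : ∀ n (p : Vec Colour (suc n) → Bool) (φ : Selector) →
  countSelected (suc n) p φ
  ≡ countSelected n (p ∘ (empty ∷_)) φ + countSelected n (p ∘ (blue ∷_)) (blueShift φ)
    + countSelected n (p ∘ (red ∷_)) (redShift φ)
countSelected-suc n p φ = count-suc {n} _

countSelected-cong : {p q : Vec Colour n → Bool} → (∀ c → p c ≡ q c) → (φ : Selector) →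
                     countSelected n p φ ≡ countSelected n q φ
countSelected-cong p≗q φ = count-cong (λ c → cong (_∧ _) (p≗q c))

countSelected-none : (p : Vec Colour n → Bool) {φ : Selector} → (∀ b r → φ b r ≡ false) →
                     countSelected n p φ ≡ 0
countSelected-none p φ≗false = count-none (λ c → trans (cong (p c ∧_) (φ≗false _ _)) (∧-zeroʳ (p c)))

profileOf : (n : ℕ) → (Vec Colour n → Bool) → Poly
profileOf n p j l = countSelected n p (monomial j l)

profile≈profileOf : (G : Graph n) → profile G ≈P profileOf n (isCisPosition G)
profile≈profileOf {n} G j l =
  trans (length-filterᵇ _ (cisPositions G)) (countᵇ-filterᵇ (isCisPosition G) _ (assignments n))

xMul-profileOf : (p : Vec Colour n → Bool) →
                 xMul (profileOf n p) ≈P (λ j l → countSelected n p (blueShift (monomial j l)))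
xMul-profileOf p zero    l = sym (countSelected-none p (λ _ _ → refl))
xMul-profileOf p (suc j) l = refl

yMul-profileOf : (p : Vec Colour n → Bool) →
                 yMul (profileOf n p) ≈P (λ j l → countSelected n p (redShift (monomial j l)))
yMul-profileOf p j zero    = sym (countSelected-none p (λ b _ → ∧-zeroʳ (b ≡ᵇ j)))
yMul-profileOf p j (suc l) = refl

evalProfile-one : (G : Graph n) → evalProfile G 1 1 ≡ countSelected n (isCisPosition G) anyMonomial
evalProfile-one {n} G = begin
  evalProfile G 1 1                                       ≡⟨ cong sum (sym (map-∘ (cisPositions G))) ⟩
  sum (map (λ c → 1 ^ countBool isBlue c * 1 ^ countBool isRed c) (cisPositions G))
                                                          ≡⟨ sum-ones (cisPositions G) ⟩
  length (cisPositions G)                                 ≡⟨ length-filterᵇ _ (assignments n) ⟩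
  count n (isCisPosition G)                               ≡⟨ count-cong {n} (λ c → sym (∧-identityʳ _)) ⟩
  countSelected n (isCisPosition G) anyMonomial           ∎
  where
  open ≡-Reasoning
  sum-ones : (cs : List (Vec Colour n)) →
             sum (map (λ c → 1 ^ countBool isBlue c * 1 ^ countBool isRed c) cs) ≡ length cs
  sum-ones []       = refl
  sum-ones (c ∷ cs) = cong₂ _+_ (cong₂ _*_ (^-zeroˡ (countBool isBlue c)) (^-zeroˡ (countBool isRed c)))
                                (sum-ones cs)

T-injective : {x y : Bool} → T x ⇔ T y → x ≡ y
T-injective x⇔y = ⇔→≡ (mk⇔ (to T-≡ ∘ to x⇔y ∘ from T-≡) (to T-≡ ∘ from x⇔y ∘ from T-≡))
  where open Equivalence

T-not-∧ : {a b : Bool} → T (not (a ∧ b)) ⇔ (T a → T (not b))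
T-not-∧ {true}  = mk⇔ (λ h _ → h) (λ f → f _)
T-not-∧ {false} = mk⇔ (λ _ ()) (λ _ → _)

Independent : Graph n → Vec Colour n → Set
Independent {n} G c = ∀ i j → T (G i j) → T (not (coloured (lookup c i) ∧ coloured (lookup c j)))

isCisPosition⇔independent : (G : Graph n) (c : Vec Colour n) → T (isCisPosition G c) ⇔ Independent G c
isCisPosition⇔independent {n} G c = mk⇔
  (λ h i j → Equivalence.to T-not-∧ (tabulate⁻ (all⁺ _ _ (tabulate⁻ (all⁺ _ _ h) i)) j))
  (λ h → all⁻ _ (tabulate⁺ (λ i → all⁻ _ (tabulate⁺ (λ j → Equivalence.from T-not-∧ (h i j))))))

-- No two adjacent coloured letters in the word b c e, where the outer letters b and e
-- say whether the outside neighbours of the ends of c are coloured.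
spacedBetween : Bool → Bool → Vec Colour n → Bool
spacedBetween b e []      = not (b ∧ e)
spacedBetween b e (x ∷ c) = not (b ∧ coloured x) ∧ spacedBetween (coloured x) e c

-- On a cycle the first vertex is the outside neighbour of the rest at both ends.
cyclicSpaced : Vec Colour (suc n) → Bool
cyclicSpaced (x ∷ c) = spacedBetween (coloured x) (coloured x) c

lastColoured : Bool → Vec Colour n → Bool
lastColoured b []      = b
lastColoured b (x ∷ c) = lastColoured (coloured x) c

spacedBetween-split : ∀ b e (c : Vec Colour n) →
                      spacedBetween b e c ≡ spacedBetween b false c ∧ not (e ∧ lastColoured b c)
spacedBetween-split true  true  []      = refl
spacedBetween-split true  false []      = refl
spacedBetween-split false true  []      = refl
spacedBetween-split false false []      = refl
spacedBetween-split b     e     (x ∷ c) =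
  trans (cong (not (b ∧ coloured x) ∧_) (spacedBetween-split (coloured x) e c))
        (sym (∧-assoc (not (b ∧ coloured x)) (spacedBetween (coloured x) false c) (not (e ∧ lastColoured (coloured x) c))))

lastColoured-lookup : ∀ x (c : Vec Colour n) → lastColoured (coloured x) c ≡ coloured (lookup (x ∷ c) (fromℕ n))
lastColoured-lookup x []      = refl
lastColoured-lookup x (y ∷ c) = lastColoured-lookup y c

spacedBetween-∷ : ∀ b e x (c : Vec Colour n) →
  T (spacedBetween b e (x ∷ c)) ⇔ (T (not (b ∧ coloured x)) × T (spacedBetween (coloured x) e c))
spacedBetween-∷ b e x c = T-∧ {not (b ∧ coloured x)} {spacedBetween (coloured x) e c}

spacedBetween-adjacent : ∀ b e x y (c : Vec Colour n) →
  T (spacedBetween b e (x ∷ y ∷ c)) → T (not (coloured x ∧ coloured y))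
spacedBetween-adjacent b e x y c =
  proj₁ ∘ to (spacedBetween-∷ (coloured x) e y c) ∘ proj₂ ∘ to (spacedBetween-∷ b e x (y ∷ c))
  where open Equivalence

spaced⇒independent : ∀ b e (c : Vec Colour n) → T (spacedBetween b e c) → Independent (pathGraph n) c
spaced⇒independent b e (x ∷ c)     s fzero           fzero           ()
spaced⇒independent b e (x ∷ y ∷ c) s fzero           (fsuc fzero)    _ = spacedBetween-adjacent b e x y c s
spaced⇒independent b e (x ∷ y ∷ c) s fzero           (fsuc (fsuc j)) ()
spaced⇒independent b e (x ∷ y ∷ c) s (fsuc fzero)    fzero           _ =
  subst (T ∘ not) (∧-comm (coloured x) (coloured y)) (spacedBetween-adjacent b e x y c s)
spaced⇒independent b e (x ∷ y ∷ c) s (fsuc (fsuc i)) fzero           ()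
spaced⇒independent b e (x ∷ c)     s (fsuc i)        (fsuc j)        =
  spaced⇒independent (coloured x) e c (proj₂ (Equivalence.to (spacedBetween-∷ b e x c) s)) i j

independent⇒spaced : ∀ b x (c : Vec Colour n) → T (not (b ∧ coloured x)) →
                     Independent (pathGraph (suc n)) (x ∷ c) → T (spacedBetween b false (x ∷ c))
independent⇒spaced b x []      bx _   =
  Equivalence.from (spacedBetween-∷ b false x []) (bx , subst (T ∘ not) (sym (∧-zeroʳ (coloured x))) _)
independent⇒spaced b x (y ∷ c) bx ind = Equivalence.from (spacedBetween-∷ b false x (y ∷ c))
  (bx , independent⇒spaced (coloured x) y c (ind fzero (fsuc fzero) _) (λ i j → ind (fsuc i) (fsuc j)))

pathGraph-position : (c : Vec Colour n) → isCisPosition (pathGraph n) c ≡ spacedBetween false false c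
pathGraph-position []      = refl
pathGraph-position (x ∷ c) = T-injective (mk⇔
  (independent⇒spaced false x c _ ∘ to (isCisPosition⇔independent _ (x ∷ c)))
  (from (isCisPosition⇔independent _ (x ∷ c)) ∘ spaced⇒independent false false (x ∷ c)))
  where open Equivalence

wrapEdge : (i j : Fin (suc n)) → T ((toℕ i ≡ᵇ 0) ∧ (suc (toℕ j) ≡ᵇ suc n)) → i ≡ fzero × j ≡ fromℕ n
wrapEdge fzero j e = refl , toℕ-injective (trans (≡ᵇ⇒≡ _ _ e) (sym (toℕ-fromℕ _)))

independent-cycle⇔ : (c : Vec Colour (suc n)) →
  Independent (cycleGraph (suc n)) c
  ⇔ (Independent (pathGraph (suc n)) c × T (not (coloured (lookup c fzero) ∧ coloured (lookup c (fromℕ n)))))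
independent-cycle⇔ {n} c = mk⇔
  (λ ind → (λ i j e → ind i j (from (T-∨ {pathGraph (suc n) i j}) (inj₁ e))) , ind fzero (fromℕ n) wrap)
  (λ (indPath , ends) → fromPathAndEnds indPath ends)
  where
  open Equivalence
  wrap : T (cycleGraph (suc n) fzero (fromℕ n))
  wrap = from (T-∨ {pathGraph (suc n) fzero (fromℕ n)}) (inj₂ (from T-∨ (inj₁ (≡⇒≡ᵇ _ _ (toℕ-fromℕ n)))))
  fromPathAndEnds : Independent (pathGraph (suc n)) c →
                T (not (coloured (lookup c fzero) ∧ coloured (lookup c (fromℕ n)))) →
                Independent (cycleGraph (suc n)) c
  fromPathAndEnds indPath ends i j e with to (T-∨ {pathGraph (suc n) i j}) e
  ... | inj₁ e-path = indPath i j e-path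
  ... | inj₂ e-wrap with to (T-∨ {(toℕ i ≡ᵇ 0) ∧ (suc (toℕ j) ≡ᵇ suc n)}) e-wrap
  ...   | inj₁ e-fwd with wrapEdge i j e-fwd
  ...     | refl , refl = ends
  fromPathAndEnds indPath ends i j e | inj₂ e-wrap | inj₂ e-bwd with wrapEdge j i e-bwd
  ...     | refl , refl = subst (T ∘ not) (∧-comm (coloured (lookup c fzero)) _) ends

cycleGraph-position : (c : Vec Colour (suc n)) → isCisPosition (cycleGraph (suc n)) c ≡ cyclicSpaced c
cycleGraph-position {n} (x ∷ c) = begin
  isCisPosition (cycleGraph (suc n)) (x ∷ c)
    ≡⟨ T-injective (mk⇔ cycle⇒path∧ends path∧ends⇒cycle) ⟩
  isCisPosition (pathGraph (suc n)) (x ∷ c) ∧ not (coloured x ∧ lastEntry)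
    ≡⟨ cong (_∧ not (coloured x ∧ lastEntry)) (pathGraph-position (x ∷ c)) ⟩
  spacedBetween (coloured x) false c ∧ not (coloured x ∧ lastEntry)
    ≡⟨ cong (λ z → spacedBetween (coloured x) false c ∧ not (coloured x ∧ z)) (lastColoured-lookup x c) ⟨
  spacedBetween (coloured x) false c ∧ not (coloured x ∧ lastColoured (coloured x) c)
    ≡⟨ spacedBetween-split (coloured x) (coloured x) c ⟨
  cyclicSpaced (x ∷ c)
    ∎
  where
  open ≡-Reasoning
  open Equivalence
  lastEntry : Bool
  lastEntry = coloured (lookup (x ∷ c) (fromℕ n))
  cycle⇒path∧ends : T (isCisPosition (cycleGraph (suc n)) (x ∷ c)) →
                    T (isCisPosition (pathGraph (suc n)) (x ∷ c) ∧ not (coloured x ∧ lastEntry))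
  cycle⇒path∧ends h with to (independent-cycle⇔ (x ∷ c)) (to (isCisPosition⇔independent _ (x ∷ c)) h)
  ... | indPath , ends = from T-∧ (from (isCisPosition⇔independent _ (x ∷ c)) indPath , ends)
  path∧ends⇒cycle : T (isCisPosition (pathGraph (suc n)) (x ∷ c) ∧ not (coloured x ∧ lastEntry)) →
                    T (isCisPosition (cycleGraph (suc n)) (x ∷ c))
  path∧ends⇒cycle h with to (T-∧ {isCisPosition (pathGraph (suc n)) (x ∷ c)}) h
  ... | path , ends = from (isCisPosition⇔independent _ (x ∷ c))
                           (from (independent-cycle⇔ (x ∷ c)) (to (isCisPosition⇔independent _ (x ∷ c)) path , ends))

countSelected-rejectColouredFirst : ∀ n (p : Vec Colour (suc n) → Bool) (φ : Selector) →
  (∀ c → p (blue ∷ c) ≡ false) → (∀ c → p (red ∷ c) ≡ false) →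
  countSelected (suc n) p φ ≡ countSelected n (p ∘ (empty ∷_)) φ
countSelected-rejectColouredFirst n p φ rejectBlue rejectRed = begin
  countSelected (suc n) p φ
    ≡⟨ countSelected-suc n p φ ⟩
  countSelected n (p ∘ (empty ∷_)) φ + countSelected n (p ∘ (blue ∷_)) (blueShift φ)
    + countSelected n (p ∘ (red ∷_)) (redShift φ)
    ≡⟨ cong₂ (λ u v → countSelected n (p ∘ (empty ∷_)) φ + u + v)
             (count-none (λ c → cong (_∧ _) (rejectBlue c))) (count-none (λ c → cong (_∧ _) (rejectRed c))) ⟩
  countSelected n (p ∘ (empty ∷_)) φ + 0 + 0
    ≡⟨ trans (+-identityʳ _) (+-identityʳ _) ⟩
  countSelected n (p ∘ (empty ∷_)) φ
    ∎
  where open ≡-Reasoning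

spacedCount-colouredStart : ∀ e t (φ : Selector) →
  countSelected (suc t) (spacedBetween true e) φ ≡ countSelected t (spacedBetween false e) φ
spacedCount-colouredStart e t φ =
  countSelected-rejectColouredFirst t (spacedBetween true e) φ (λ _ → refl) (λ _ → refl)

spacedCount-colouredEnd : ∀ b t (φ : Selector) →
  countSelected (suc t) (spacedBetween b true) φ ≡ countSelected t (spacedBetween b false) φ
spacedCount-colouredEnd true  zero    φ = refl
spacedCount-colouredEnd true  (suc t) φ = begin
  countSelected (2 + t) (spacedBetween true true) φ   ≡⟨ spacedCount-colouredStart true (suc t) φ ⟩
  countSelected (1 + t) (spacedBetween false true) φ  ≡⟨ spacedCount-colouredEnd false t φ ⟩
  countSelected t (spacedBetween false false) φ       ≡⟨ spacedCount-colouredStart false t φ ⟨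
  countSelected (1 + t) (spacedBetween true false) φ  ∎
  where open ≡-Reasoning
spacedCount-colouredEnd false zero    φ =
  trans (countSelected-suc 0 (spacedBetween false true) φ) (trans (+-identityʳ _) (+-identityʳ _))
spacedCount-colouredEnd false (suc t) φ = begin
  countSelected (2 + t) (spacedBetween false true) φ
    ≡⟨ countSelected-suc (1 + t) (spacedBetween false true) φ ⟩
  countSelected (1 + t) (spacedBetween false true) φ + countSelected (1 + t) (spacedBetween true true) (blueShift φ)
    + countSelected (1 + t) (spacedBetween true true) (redShift φ)
    ≡⟨ cong₂ _+_ (cong₂ _+_ (spacedCount-colouredEnd false t φ) (spacedCount-colouredEnd true t (blueShift φ)))
                 (spacedCount-colouredEnd true t (redShift φ)) ⟩
  countSelected t (spacedBetween false false) φ + countSelected t (spacedBetween true false) (blueShift φ)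
    + countSelected t (spacedBetween true false) (redShift φ)
    ≡⟨ countSelected-suc t (spacedBetween false false) φ ⟨
  countSelected (1 + t) (spacedBetween false false) φ
    ∎
  where open ≡-Reasoning

spacedCount-cycle : ∀ t (φ : Selector) →
  countSelected (3 + t) cyclicSpaced φ
  ≡ countSelected (2 + t) (spacedBetween false false) φ + countSelected t (spacedBetween false false) (blueShift φ)
    + countSelected t (spacedBetween false false) (redShift φ)
spacedCount-cycle t φ =
  trans (countSelected-suc (2 + t) cyclicSpaced φ)
        (cong₂ (λ u v → countSelected (2 + t) (spacedBetween false false) φ + u + v)
               (colouredBothEnds (blueShift φ)) (colouredBothEnds (redShift φ)))
  where
  colouredBothEnds : (ψ : Selector) →
    countSelected (2 + t) (spacedBetween true true) ψ ≡ countSelected t (spacedBetween false false) ψ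
  colouredBothEnds ψ = trans (spacedCount-colouredStart true (suc t) ψ) (spacedCount-colouredEnd false t ψ)

pathCount : ℕ → ℕ
pathCount t = countSelected t (spacedBetween false false) anyMonomial

pathCount-rec : ∀ t → pathCount (2 + t) ≡ pathCount (1 + t) + pathCount t + pathCount t
pathCount-rec t =
  trans (countSelected-suc (1 + t) (spacedBetween false false) anyMonomial)
        (cong₂ (λ u v → pathCount (1 + t) + u + v)
               (spacedCount-colouredStart false t anyMonomial) (spacedCount-colouredStart false t anyMonomial))

pos-+³ : ∀ a b c → + (a + b + c) ≡ + a +ℤ + b +ℤ + c
pos-+³ a b c = trans (pos-+ (a + b) c) (cong (_+ℤ + c) (pos-+ a b))

JacobsthalRecurrence : (ℕ → ℤ) → Set
JacobsthalRecurrence s = ∀ n → s (2 + n) ≡ s (1 + n) +ℤ + 2 *ℤ s n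

jacobsthal-unique : {s u : ℕ → ℤ} → JacobsthalRecurrence s → JacobsthalRecurrence u →
                    s 0 ≡ u 0 → s 1 ≡ u 1 → ∀ n → s n ≡ u n
jacobsthal-unique {s} {u} rec-s rec-u s₀ s₁ n = proj₁ (agreeFrom n)
  where
  agreeFrom : ∀ n → s n ≡ u n × s (1 + n) ≡ u (1 + n)
  agreeFrom zero    = s₀ , s₁
  agreeFrom (suc n) with agreeFrom n
  ... | sₙ , sₙ₊₁ = sₙ₊₁ , trans (rec-s n) (trans (cong₂ (λ a b → a +ℤ + 2 *ℤ b) sₙ₊₁ sₙ)
                                                 (sym (rec-u n)))

jacobsthal-2^n+[-1]^n : JacobsthalRecurrence (λ n → (+ 2) ^ℤ n +ℤ -[1+ 0 ] ^ℤ n)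
jacobsthal-2^n+[-1]^n n = identity ((+ 2) ^ℤ n) (-[1+ 0 ] ^ℤ n)
  where
  open ℤ-Solver using (solve-∀)
  identity : ∀ a e → + 2 *ℤ (+ 2 *ℤ a) +ℤ -[1+ 0 ] *ℤ (-[1+ 0 ] *ℤ e)
                     ≡ (+ 2 *ℤ a +ℤ -[1+ 0 ] *ℤ e) +ℤ + 2 *ℤ (a +ℤ e)
  identity = solve-∀

jacobsthal-pathCount : JacobsthalRecurrence (+_ ∘ pathCount)
jacobsthal-pathCount t = begin
  + pathCount (2 + t)                                         ≡⟨ cong +_ (pathCount-rec t) ⟩
  + (pathCount (1 + t) + pathCount t + pathCount t)           ≡⟨ pos-+³ (pathCount (1 + t)) (pathCount t) (pathCount t) ⟩
  + pathCount (1 + t) +ℤ + pathCount t +ℤ + pathCount t       ≡⟨ double (+ pathCount (1 + t)) (+ pathCount t) ⟩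
  + pathCount (1 + t) +ℤ + 2 *ℤ + pathCount t                 ∎
  where
  open ≡-Reasoning
  open ℤ-Solver using (solve-∀)
  double : ∀ a b → a +ℤ b +ℤ b ≡ a +ℤ + 2 *ℤ b
  double = solve-∀

jacobsthal-cycle : {s : ℕ → ℤ} → JacobsthalRecurrence s →
                   JacobsthalRecurrence (λ n → s (2 + n) +ℤ s n +ℤ s n)
jacobsthal-cycle {s} rec n =
  trans (cong (λ a → a +ℤ s (2 + n) +ℤ s (2 + n)) (rec (2 + n)))
        (regroup (s (3 + n)) (s (1 + n)) (s n) (s (2 + n)) (rec n))
  where
  open ℤ-Solver using (solve-∀)
  identity : ∀ a₃ a₁ a₀ → let b = a₁ +ℤ + 2 *ℤ a₀ in
             (a₃ +ℤ + 2 *ℤ b) +ℤ b +ℤ b ≡ (a₃ +ℤ a₁ +ℤ a₁) +ℤ + 2 *ℤ (b +ℤ a₀ +ℤ a₀)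
  identity = solve-∀
  regroup : ∀ a₃ a₁ a₀ b → b ≡ a₁ +ℤ + 2 *ℤ a₀ →
            (a₃ +ℤ + 2 *ℤ b) +ℤ b +ℤ b ≡ (a₃ +ℤ a₁ +ℤ a₁) +ℤ + 2 *ℤ (b +ℤ a₀ +ℤ a₀)
  regroup a₃ a₁ a₀ _ refl = identity a₃ a₁ a₀

cycleCount-closedForm : ∀ t → + (pathCount (2 + t) + pathCount t + pathCount t)
                              ≡ (+ 2) ^ℤ (3 + t) +ℤ -[1+ 0 ] ^ℤ (3 + t)
cycleCount-closedForm t =
  trans (pos-+³ (pathCount (2 + t)) (pathCount t) (pathCount t))
        (jacobsthal-unique {s = cycleCount} {u = closedForm}
                           (jacobsthal-cycle {+_ ∘ pathCount} jacobsthal-pathCount)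
                           (λ n → jacobsthal-2^n+[-1]^n (3 + n)) refl refl t)
  where
  cycleCount closedForm : ℕ → ℤ
  cycleCount n = + pathCount (2 + n) +ℤ + pathCount n +ℤ + pathCount n
  closedForm n = (+ 2) ^ℤ (3 + n) +ℤ -[1+ 0 ] ^ℤ (3 + n)

evalProfile-cycleGraph : ∀ t →
  evalProfile (cycleGraph (3 + t)) 1 1 ≡ pathCount (2 + t) + pathCount t + pathCount t
evalProfile-cycleGraph t =
  trans (evalProfile-one (cycleGraph (3 + t)))
        (trans (countSelected-cong (cycleGraph-position {2 + t}) anyMonomial) (spacedCount-cycle t anyMonomial))

xMul-cong : {p q : Poly} → p ≈P q → xMul p ≈P xMul q
xMul-cong p≈q zero    l = refl
xMul-cong p≈q (suc j) l = p≈q j l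

yMul-cong : {p q : Poly} → p ≈P q → yMul p ≈P yMul q
yMul-cong p≈q j zero    = refl
yMul-cong p≈q j (suc l) = p≈q j l

profile-pathGraph : profile (pathGraph n) ≈P profileOf n (spacedBetween false false)
profile-pathGraph {n} j l =
  trans (profile≈profileOf (pathGraph n) j l) (countSelected-cong (pathGraph-position {n}) (monomial j l))

profile-cycleGraph : ∀ t →
  profile (cycleGraph (3 + t)) ≈P (profile (pathGraph (2 + t)) ⊕ x+yMul (profile (pathGraph t)))
profile-cycleGraph t j l = begin
  profile (cycleGraph (3 + t)) j l
    ≡⟨ profile≈profileOf (cycleGraph (3 + t)) j l ⟩
  profileOf (3 + t) (isCisPosition (cycleGraph (3 + t))) j l
    ≡⟨ countSelected-cong (cycleGraph-position {2 + t}) (monomial j l) ⟩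
  countSelected (3 + t) cyclicSpaced (monomial j l)
    ≡⟨ spacedCount-cycle t (monomial j l) ⟩
  profileOf (2 + t) spaced j l + countSelected t spaced (blueShift (monomial j l))
    + countSelected t spaced (redShift (monomial j l))
    ≡⟨ +-assoc (profileOf (2 + t) spaced j l) _ _ ⟩
  profileOf (2 + t) spaced j l + (countSelected t spaced (blueShift (monomial j l))
    + countSelected t spaced (redShift (monomial j l)))
    ≡⟨ cong₂ (λ a b → profileOf (2 + t) spaced j l + (a + b))
             (xMul-profileOf {t} spaced j l) (yMul-profileOf {t} spaced j l) ⟨
  profileOf (2 + t) spaced j l + (xMul (profileOf t spaced) j l + yMul (profileOf t spaced) j l)
    ≡⟨ cong₂ _+_ (profile-pathGraph {2 + t} j l)
             (cong₂ _+_ (xMul-cong (profile-pathGraph {t}) j l) (yMul-cong (profile-pathGraph {t}) j l)) ⟨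
  (profile (pathGraph (2 + t)) ⊕ x+yMul (profile (pathGraph t))) j l
    ∎
  where
  open ≡-Reasoning
  spaced : ∀ {m} → Vec Colour m → Bool
  spaced = spacedBetween false false

mainTheorem6 : (n : ℕ) → 4 ≤ n →
    (profile (cycleGraph n) ≈P (profile (pathGraph (n ∸ 1)) ⊕ x+yMul (profile (pathGraph (n ∸ 3)))))
    × (+ evalProfile (cycleGraph n) 1 1 ≡ (+ 2) ^ℤ n +ℤ (-[1+ 0 ] ^ℤ n))
mainTheorem6 (suc (suc (suc (suc k)))) (s≤s (s≤s (s≤s (s≤s _)))) =
  profile-cycleGraph (suc k) , trans (cong +_ (evalProfile-cycleGraph (suc k))) (cycleCount-closedForm (suc k))
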